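{- Let $r\geq 2$ and $q\geq 1$ be integers. Let $G$ be a hypergraph whose edges have sizes between $2$ and $r$, and suppose $G$ is $(2,q)$-linear. Then $G$ contains a linear subgraph $G'$ with $|G'|\geq \frac{2}{qr^2}|G|$.
   Context: A hypergraph is $(2,q)$-linear if no pair of vertices is contained in $q$ or more of its edges. A hypergraph is linear if any two distinct edges share at most one vertex. $|G|$ denotes the number of edges. -}

module Defs where

open import Data.Nat using (ℕ; _≤_; _<_)
open import Data.Fin using (Fin)
open import Data.Fin.Subset using (Subset; ∣_∣; _∈_; _∩_)
open import Data.List using (List; length; filter; lookup)
open import Data.Product using (_×_)
open import Relation.Binary.PropositionalEquality using (_≡_)
open import Relation.Nullary using (¬_)
open import Data.Fin.Subset.Properties using (_∈?_)
open import Relation.Nullary.Decidable using (_×-dec_)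

-- A hypergraph on the vertex set Fin n: a finite list (multiset) of edges,
-- each edge a subset of the vertices.
Hypergraph : ℕ → Set
Hypergraph n = List (Subset n)

numEdges : ∀ {n} → Hypergraph n → ℕ
numEdges = length

EdgeSizesIn : ∀ {n} → ℕ → Hypergraph n → Set
EdgeSizesIn {n} r G = ∀ (i : Fin (length G)) → 2 ≤ ∣ lookup G i ∣ × ∣ lookup G i ∣ ≤ r

codegree : ∀ {n} → Hypergraph n → Fin n → Fin n → ℕ
codegree G u v = length (filter (λ e → (u ∈? e) ×-dec (v ∈? e)) G)

TwoQLinear : ∀ {n} → ℕ → Hypergraph n → Set
TwoQLinear {n} q G = ∀ (u v : Fin n) → ¬ (u ≡ v) → codegree G u v < q

Linear : ∀ {n} → Hypergraph n → Set
Linear G = ∀ (i j : Fin (length G)) → ¬ (i ≡ j) → ∣ lookup G i ∩ lookup G j ∣ ≤ 1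

module Submission where

-- Greedy: keep the first edge e and discard every later edge meeting e in two vertices.
-- Such an edge contains one of the at most |e|²/2 vertex pairs of e, and each pair lies in
-- at most q − 1 further edges; so each kept edge accounts for at most 1 + (q − 1) r²/2 ≤ q r²/2
-- edges of G.

open import Defs
open import Data.Nat using (ℕ; _≤_; _*_)
open import Data.Product using (Σ; _×_)
open import Data.List.Relation.Binary.Sublist.Propositional using (_⊆_)

open import Data.Empty using (⊥-elim)
open import Data.Fin using (Fin; zero; suc)
open import Data.Fin.Properties using (suc-injective)
open import Data.Fin.Subset using (Subset; ∣_∣; _∩_; inside; outside)
  renaming (_∈_ to _∈ₛ_)
open import Data.Vec using ([]; _∷_; here; there)
open import Data.Fin.Subset.Properties using (_∈?_; ∩-comm; x∈p∩q⁻)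
open import Data.List using (List; []; _∷_; length; filter; lookup; map; _++_)
open import Data.List.Properties using (length-map; length-++; length-filter)
open import Data.List.Membership.Propositional using (_∈_)
open import Data.List.Membership.Propositional.Properties using (∈-map⁺; ∈-map⁻; ∈-lookup)
open import Data.List.Relation.Binary.Sublist.Propositional using ([]; _∷_; _∷ʳ_; ⊆-refl; ⊆-trans)
open import Data.List.Relation.Binary.Sublist.Propositional.Properties
  using (All-resp-⊆; filter-⊆; length-mono-≤)
  renaming (filter⁺ to filter-⊆-filter)
open import Data.List.Relation.Unary.All using (All; []; _∷_)
import Data.List.Relation.Unary.All as All
open import Data.List.Relation.Unary.All.Properties using (all-filter; filter⁺; ++⁺)
  renaming (map⁺ to All-map⁺)
open import Data.List.Relation.Unary.Any using (Any; here; there)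
import Data.List.Relation.Unary.Any as Any
open import Data.List.Relation.Unary.Any.Properties using (++⁺ˡ; ++⁺ʳ)
  renaming (map⁺ to Any-map⁺)
open import Data.List.Relation.Unary.AllPairs using (AllPairs; []; _∷_)
open import Data.List.Relation.Unary.Unique.Propositional using (Unique)
import Data.List.Relation.Unary.Unique.Propositional.Properties as Unique
open import Data.Nat using (suc; _+_; _≤?_; z≤n; s≤s)
open import Data.Nat.Properties
  using ( +-suc; +-mono-≤; *-assoc; *-mono-≤; *-monoˡ-≤; *-monoʳ-≤; m≤m+n
        ; ≤-refl; ≤-trans; ≤-<-trans; ≤-pred; ≰⇒>; module ≤-Reasoning)
open import Data.Nat.Tactic.RingSolver using (solve-∀)
open import Data.Product using (_,_; proj₁; proj₂; ∃₂; uncurry)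
open import Function using (_∘_)
open import Relation.Binary.PropositionalEquality
  using (_≡_; _≢_; refl; sym; trans; cong; cong₂; subst; module ≡-Reasoning)
open import Relation.Nullary using (¬_; yes; no)
open import Relation.Nullary.Decidable using (_×-dec_)
open import Relation.Unary using (Decidable)
open import Relation.Unary.Properties using (∁?)

private variable
  A B : Set
  n : ℕ

length-filter-∁ : {P : A → Set} (P? : Decidable P) (xs : List A) →
  length (filter P? xs) + length (filter (∁? P?) xs) ≡ length xs
length-filter-∁ P? [] = refl
length-filter-∁ P? (x ∷ xs) with P? x
... | yes _ = cong suc (length-filter-∁ P? xs)
... | no _ = trans (+-suc _ _) (cong suc (length-filter-∁ P? xs))

length-≤-covered : {Q : B → A → Set} (Q? : ∀ p → Decidable (Q p)) {c : ℕ} (ps : List B)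
  {xs ys : List A} → All (λ p → length (filter (Q? p) xs) ≤ c) ps → ys ⊆ xs →
  All (λ y → Any (λ p → Q p y) ps) ys → length ys ≤ length ps * c
length-≤-covered Q? [] _ _ [] = z≤n
length-≤-covered Q? [] _ _ (() ∷ _)
length-≤-covered {Q = Q} Q? {c} (p ∷ ps) {xs} {ys} (bound ∷ bounds) ys⊆xs covered = begin
  length ys
    ≡⟨ length-filter-∁ (Q? p) ys ⟨
  length (filter (Q? p) ys) + length (filter (∁? (Q? p)) ys)
    ≤⟨ +-mono-≤ (≤-trans (length-mono-≤ (filter-⊆-filter (Q? p) (Q? p) (λ { refl q → q }) ys⊆xs)) bound)
                 (length-≤-covered Q? ps bounds (⊆-trans (filter-⊆ (∁? (Q? p)) ys) ys⊆xs) rest) ⟩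
  c + length ps * c ∎
  where
  open ≤-Reasoning
  rest : All (λ y → Any (λ p → Q p y) ps) (filter (∁? (Q? p)) ys)
  rest = All.zipWith (uncurry Any.tail) (all-filter (∁? (Q? p)) ys , filter⁺ (∁? (Q? p)) covered)

pairs : List A → List (A × A)
pairs [] = []
pairs (x ∷ xs) = map (x ,_) xs ++ pairs xs

length-pairs : (xs : List A) → 2 * length (pairs xs) + length xs ≡ length xs * length xs
length-pairs [] = refl
length-pairs (x ∷ xs) = begin
  2 * length (map (x ,_) xs ++ pairs xs) + suc k
    ≡⟨ cong (λ m → 2 * m + suc k)
         (trans (length-++ (map (x ,_) xs)) (cong (_+ length (pairs xs)) (length-map (x ,_) xs))) ⟩
  2 * (k + length (pairs xs)) + suc k
    ≡⟨ step k (length (pairs xs)) ⟩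
  2 * k + suc (2 * length (pairs xs) + k)
    ≡⟨ cong (λ m → 2 * k + suc m) (length-pairs xs) ⟩
  2 * k + suc (k * k)
    ≡⟨ square-suc k ⟩
  suc k * suc k ∎
  where
  open ≡-Reasoning
  k = length xs
  step : ∀ k P → 2 * (k + P) + suc k ≡ 2 * k + suc (2 * P + k)
  step = solve-∀
  square-suc : ∀ k → 2 * k + suc (k * k) ≡ suc k * suc k
  square-suc = solve-∀

pairs-All : {R : A → A → Set} {xs : List A} → AllPairs R xs → All (uncurry R) (pairs xs)
pairs-All [] = []
pairs-All (Rx ∷ Rxs) = ++⁺ (All-map⁺ Rx) (pairs-All Rxs)

pairs-Any : {P : A → Set} {xs : List A} {x y : A} → x ∈ xs → y ∈ xs → x ≢ y → P x → P y →
  Any (λ p → P (proj₁ p) × P (proj₂ p)) (pairs xs)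
pairs-Any (here refl) (here refl) x≢y _ _ = ⊥-elim (x≢y refl)
pairs-Any (here refl) (there y∈) _ Px Py = ++⁺ˡ (Any-map⁺ (Any.map (λ { refl → Px , Py }) y∈))
pairs-Any (there x∈) (here refl) _ Px Py = ++⁺ˡ (Any-map⁺ (Any.map (λ { refl → Py , Px }) x∈))
pairs-Any {xs = z ∷ zs} (there x∈) (there y∈) x≢y Px Py =
  ++⁺ʳ (map (z ,_) zs) (pairs-Any x∈ y∈ x≢y Px Py)

unique-distinct-∈ : {xs : List A} → Unique xs → 2 ≤ length xs → ∃₂ λ x y → x ≢ y × x ∈ xs × y ∈ xs
unique-distinct-∈ {xs = x ∷ y ∷ _} ((x≢y ∷ _) ∷ _) _ = x , y , x≢y , here refl , there (here refl)
unique-distinct-∈ {xs = _ ∷ []} _ (s≤s ())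

elements : Subset n → List (Fin n)
elements [] = []
elements (inside ∷ p) = zero ∷ map suc (elements p)
elements (outside ∷ p) = map suc (elements p)

length-elements : (p : Subset n) → length (elements p) ≡ ∣ p ∣
length-elements [] = refl
length-elements (inside ∷ p) = cong suc (trans (length-map suc (elements p)) (length-elements p))
length-elements (outside ∷ p) = trans (length-map suc (elements p)) (length-elements p)

elements-unique : (p : Subset n) → Unique (elements p)
elements-unique [] = []
elements-unique (inside ∷ p) =
  All-map⁺ (All.universal (λ _ ()) (elements p)) ∷ Unique.map⁺ suc-injective (elements-unique p)
elements-unique (outside ∷ p) = Unique.map⁺ suc-injective (elements-unique p)

∈-elements⁺ : {x : Fin n} (p : Subset n) → x ∈ₛ p → x ∈ elements p
∈-elements⁺ (inside ∷ p) here = here refl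
∈-elements⁺ (inside ∷ p) (there x∈p) = there (∈-map⁺ suc (∈-elements⁺ p x∈p))
∈-elements⁺ (outside ∷ p) (there x∈p) = ∈-map⁺ suc (∈-elements⁺ p x∈p)

∈-elements⁻ : {x : Fin n} (p : Subset n) → x ∈ elements p → x ∈ₛ p
∈-elements⁻ (inside ∷ p) (here refl) = here
∈-elements⁻ (inside ∷ p) (there x∈) with ∈-map⁻ suc x∈
... | _ , y∈ , refl = there (∈-elements⁻ p y∈)
∈-elements⁻ (outside ∷ p) x∈ with ∈-map⁻ suc x∈
... | _ , y∈ , refl = there (∈-elements⁻ p y∈)

distinct-∈ₛ : (p : Subset n) → 2 ≤ ∣ p ∣ → ∃₂ λ x y → x ≢ y × x ∈ₛ p × y ∈ₛ p
distinct-∈ₛ p 2≤∣p∣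
  with x , y , x≢y , x∈ , y∈ ←
         unique-distinct-∈ (elements-unique p) (subst (2 ≤_) (sym (length-elements p)) 2≤∣p∣)
  = x , y , x≢y , ∈-elements⁻ p x∈ , ∈-elements⁻ p y∈

AllPairs-lookup : {R : A → A → Set} {xs : List A} → (∀ x y → R x y → R y x) → AllPairs R xs →
  ∀ i j → i ≢ j → R (lookup xs i) (lookup xs j)
AllPairs-lookup R-sym (Rx ∷ Rxs) zero zero i≢j = ⊥-elim (i≢j refl)
AllPairs-lookup R-sym (Rx ∷ Rxs) zero (suc j) _ = All.lookup Rx (∈-lookup j)
AllPairs-lookup R-sym (Rx ∷ Rxs) (suc i) zero _ = R-sym _ _ (All.lookup Rx (∈-lookup i))
AllPairs-lookup R-sym (Rx ∷ Rxs) (suc i) (suc j) i≢j = AllPairs-lookup R-sym Rxs i j (i≢j ∘ cong suc)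

AlmostDisjoint : Subset n → Subset n → Set
AlmostDisjoint e f = ∣ e ∩ f ∣ ≤ 1

almostDisjoint? : (e : Subset n) → Decidable (AlmostDisjoint e)
almostDisjoint? e f = ∣ e ∩ f ∣ ≤? 1

almostDisjoint-sym : (e f : Subset n) → AlmostDisjoint e f → AlmostDisjoint f e
almostDisjoint-sym e f = subst (λ s → ∣ s ∣ ≤ 1) (∩-comm e f)

Covers : Fin n × Fin n → Subset n → Set
Covers p f = proj₁ p ∈ₛ f × proj₂ p ∈ₛ f

covers? : (p : Fin n × Fin n) → Decidable (Covers p)
covers? p f = (proj₁ p ∈? f) ×-dec (proj₂ p ∈? f)

codegree-mono : {G H : Hypergraph n} → G ⊆ H → ∀ u v → codegree G u v ≤ codegree H u v
codegree-mono G⊆H u v =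
  length-mono-≤ (filter-⊆-filter (covers? (u , v)) (covers? (u , v)) (λ { refl c → c }) G⊆H)

TwoQLinear-⊆ : {q : ℕ} {G H : Hypergraph n} → G ⊆ H → TwoQLinear q H → TwoQLinear q G
TwoQLinear-⊆ G⊆H H-lin u v u≢v = ≤-<-trans (codegree-mono G⊆H u v) (H-lin u v u≢v)

vertexPairs : Subset n → List (Fin n × Fin n)
vertexPairs e = pairs (elements e)

2*length-vertexPairs : (e : Subset n) → 2 * length (vertexPairs e) ≤ ∣ e ∣ * ∣ e ∣
2*length-vertexPairs e = begin
  2 * length (pairs (elements e))                     ≤⟨ m≤m+n _ _ ⟩
  2 * length (pairs (elements e)) + length (elements e) ≡⟨ length-pairs (elements e) ⟩
  length (elements e) * length (elements e)           ≡⟨ cong₂ _*_ (length-elements e) (length-elements e) ⟩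
  ∣ e ∣ * ∣ e ∣ ∎
  where open ≤-Reasoning

¬almostDisjoint⇒covered : (e f : Subset n) → ¬ AlmostDisjoint e f →
  Any (λ p → Covers p f) (vertexPairs e)
¬almostDisjoint⇒covered e f ¬e⋓f
  with x , y , x≢y , x∈e∩f , y∈e∩f ← distinct-∈ₛ (e ∩ f) (≰⇒> ¬e⋓f)
  with x∈e , x∈f ← x∈p∩q⁻ e f x∈e∩f
  with y∈e , y∈f ← x∈p∩q⁻ e f y∈e∩f
  = pairs-Any (∈-elements⁺ e x∈e) (∈-elements⁺ e y∈e) x≢y x∈f y∈f

-- Every edge meeting e in two vertices contains one of the pairs of e, each of which
-- lies in at most q edges.
2*length-conflicts : {q : ℕ} (e : Subset n) (es : Hypergraph n) → TwoQLinear (suc q) es →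
  2 * length (filter (∁? (almostDisjoint? e)) es) ≤ ∣ e ∣ * ∣ e ∣ * q
2*length-conflicts {q = q} e es es-lin = begin
  2 * length (filter (∁? (almostDisjoint? e)) es)   ≤⟨ *-monoʳ-≤ 2 conflicts≤ ⟩
  2 * (length (vertexPairs e) * q)                 ≡⟨ *-assoc 2 (length (vertexPairs e)) q ⟨
  2 * length (vertexPairs e) * q                   ≤⟨ *-monoˡ-≤ q (2*length-vertexPairs e) ⟩
  ∣ e ∣ * ∣ e ∣ * q ∎
  where
  open ≤-Reasoning
  conflicts≤ : length (filter (∁? (almostDisjoint? e)) es) ≤ length (vertexPairs e) * q
  conflicts≤ = length-≤-covered covers? (vertexPairs e)
    (All.map (λ {p} u≢v → ≤-pred (es-lin (proj₁ p) (proj₂ p) u≢v)) (pairs-All (elements-unique e)))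
    (filter-⊆ (∁? (almostDisjoint? e)) es)
    (All.map (¬almostDisjoint⇒covered e _) (all-filter (∁? (almostDisjoint? e)) es))

greedy-count : ∀ {R q h c g} → 2 ≤ R → 2 * h ≤ suc q * R * g → 2 * c ≤ R * q →
  2 * suc (h + c) ≤ suc q * R * suc g
greedy-count {R} {q} {h} {c} {g} 2≤R 2h≤ 2c≤ = begin
  2 * suc (h + c)          ≡⟨ expand h c ⟩
  2 + (2 * h + 2 * c)      ≤⟨ +-mono-≤ 2≤R (+-mono-≤ 2h≤ 2c≤) ⟩
  R + (suc q * R * g + R * q) ≡⟨ collect R q g ⟩
  suc q * R * suc g ∎
  where
  open ≤-Reasoning
  expand : ∀ h c → 2 * suc (h + c) ≡ 2 + (2 * h + 2 * c)
  expand = solve-∀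
  collect : ∀ R q g → R + (suc q * R * g + R * q) ≡ suc q * R * suc g
  collect = solve-∀

-- The theorem's conclusion, with AllPairs in place of the index-based Linear.
LargeAlmostDisjointSubgraph : ℕ → Hypergraph n → Set
LargeAlmostDisjointSubgraph {n} K G =
  Σ (Hypergraph n) λ G′ → G′ ⊆ G × AllPairs AlmostDisjoint G′ × 2 * length G ≤ K * length G′

keep-first : {r q : ℕ} → 2 ≤ r → (e : Subset n) (es : Hypergraph n) → ∣ e ∣ ≤ r →
  TwoQLinear (suc q) (e ∷ es) →
  LargeAlmostDisjointSubgraph (suc q * (r * r)) (filter (almostDisjoint? e) es) →
  LargeAlmostDisjointSubgraph (suc q * (r * r)) (e ∷ es)
keep-first {r = r} {q} 2≤r e es |e|≤r G-lin (G₀ , G₀⊆kept , G₀-disjoint , G₀-count) =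
  e ∷ G₀
  , refl ∷ ⊆-trans G₀⊆kept (filter-⊆ _ es)
  , All-resp-⊆ G₀⊆kept (all-filter _ es) ∷ G₀-disjoint
  , subst (λ l → 2 * suc l ≤ suc q * (r * r) * suc (length G₀))
      (length-filter-∁ (almostDisjoint? e) es)
      (greedy-count {h = length (filter (almostDisjoint? e) es)}
        (*-mono-≤ 2≤r (≤-trans (s≤s z≤n) 2≤r)) G₀-count conflicts≤)
  where
  conflicts≤ : 2 * length (filter (∁? (almostDisjoint? e)) es) ≤ r * r * q
  conflicts≤ = ≤-trans (2*length-conflicts e es (TwoQLinear-⊆ (e ∷ʳ ⊆-refl) G-lin))
                       (*-monoˡ-≤ q (*-mono-≤ |e|≤r |e|≤r))

-- m bounds |G|, so that recursing on a filtered list is structural.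
greedy : {r q : ℕ} → 2 ≤ r → (m : ℕ) (G : Hypergraph n) → length G ≤ m →
  All (λ e → ∣ e ∣ ≤ r) G → TwoQLinear (suc q) G → LargeAlmostDisjointSubgraph (suc q * (r * r)) G
greedy 2≤r m [] _ _ _ = [] , [] , [] , z≤n
greedy 2≤r (suc m) (e ∷ es) (s≤s |es|≤m) (|e|≤r ∷ sizes) G-lin =
  keep-first 2≤r e es |e|≤r G-lin
    (greedy 2≤r m (filter (almostDisjoint? e) es) (≤-trans (length-filter _ es) |es|≤m) (filter⁺ _ sizes)
      (TwoQLinear-⊆ (⊆-trans (filter-⊆ _ es) (e ∷ʳ ⊆-refl)) G-lin))

EdgeSizesIn⇒All : {r : ℕ} (G : Hypergraph n) → EdgeSizesIn r G → All (λ e → ∣ e ∣ ≤ r) G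
EdgeSizesIn⇒All [] _ = []
EdgeSizesIn⇒All (e ∷ G) sizes = proj₂ (sizes zero) ∷ EdgeSizesIn⇒All G (sizes ∘ suc)

lemma7p7 : ∀ (r q : ℕ) → 2 ≤ r → 1 ≤ q → ∀ {n : ℕ} (G : Hypergraph n) →
    EdgeSizesIn r G → TwoQLinear q G →
    Σ (Hypergraph n) (λ G′ → (G′ ⊆ G) × Linear G′ × (2 * numEdges G ≤ q * (r * r) * numEdges G′))
lemma7p7 r (suc q) 2≤r _ G sizes G-lin
  with G′ , G′⊆G , G′-disjoint , count ← greedy 2≤r (length G) G ≤-refl (EdgeSizesIn⇒All G sizes) G-lin
  = G′ , G′⊆G , AllPairs-lookup almostDisjoint-sym G′-disjoint , count
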